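{- Let $d\ge3$, $h\ge1$ and $1\le n\le h$. Let $j_1\neq j_2$ be two vertices at depth $n$ of $\mathcal{T}(d,h)$ with the same parent. Then the order of $\bar{\mathbf{x}}_{j_1}-\bar{\mathbf{x}}_{j_2}$ in the sandpile group $G(d,h)$ is $\theta(d,h+2-n)$, where $\theta(d,m)=\frac{(d-1)^m-1}{d-2}$.
   Context: Let $\mathcal{T}(d,h)$ be the ball of radius $h$ about a root vertex $0$ in the infinite $d$-regular tree (root has $d$ children, vertices at depth $1,\dots,h-1$ have $d-1$ children, depth-$h$ vertices are leaves; depth is the distance from $0$). Let $V$ be its vertex set, $p(i)$ the parent of $i\neq 0$, $C_i$ the children of $i$, $\{\mathbf{x}_i\}$ the standard basis of $\mathbb{Z}^V$, and $\delta_i = d\mathbf{x}_i - \mathbf{x}_{p(i)} - \sum_{j\in C_i}\mathbf{x}_j$ (omit $\mathbf{x}_{p(i)}$ for $i=0$). The sandpile group is $G(d,h)=\mathbb{Z}^V/\sum_{i\in V}\mathbb{Z}\delta_i$, and $\bar{\mathbf{v}}$ denotes the image of $\mathbf{v}\in\mathbb{Z}^V$. -}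

module Defs where

open import Data.Nat as ℕ using (ℕ; zero; suc; _∸_; _^_; _<_; _≤_; _<?_; NonZero; >-nonZero)
open import Data.Nat.Properties using (<-trans; n<1+n; ∸-monoˡ-≤)
open import Data.Nat.DivMod using (_/_)
open import Data.Integer as ℤ using (ℤ; +_; -_)
open import Data.Fin as Fin using (Fin; toℕ)
open import Data.Fin.Properties using (toℕ<n)
open import Data.Vec as Vec using (Vec; []; _∷_)
import Data.Vec.Properties as VecP
open import Data.List as List using (List; []; _∷_; map; concatMap; allFin; sum)
open import Data.Maybe using (Maybe; just; nothing)
open import Data.Product using (Σ; ∃; _×_; _,_)
open import Relation.Nullary using (Dec; yes; no; ¬_)
open import Relation.Binary.PropositionalEquality using (_≡_; refl; cong)

-- Vertices of T(d,h).
-- root            : the root 0 (depth 0)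
-- node k _ c p    : the vertex of depth (suc k) (so suc k ≤ h, i.e. k < h)
--                   reached from the root by going to child c (of d) and then
--                   following the path p of k child-choices (each among d-1),
--                   p listed from the deepest step first (head = last step).

data Vtx (d h : ℕ) : Set where
  root : Vtx d h
  node : (k : ℕ) → .(k < h) → Fin d → Vec (Fin (d ∸ 1)) k → Vtx d h

module _ {d h : ℕ} where

  depth : Vtx d h → ℕ
  depth root = 0
  depth (node k _ _ _) = suc k

  parent : Vtx d h → Maybe (Vtx d h)
  parent root = nothing
  parent (node zero _ c []) = just root
  parent (node (suc k) k<h c (a ∷ p)) = just (node k (<-trans (n<1+n k) k<h) c p)

  children : Vtx d h → List (Vtx d h)
  children root with 0 <? h
  ... | yes 0<h = map (λ c → node 0 0<h c []) (allFin d)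
  ... | no _ = []
  children (node k _ c p) with suc k <? h
  ... | yes sk<h = map (λ a → node (suc k) sk<h c (a ∷ p)) (allFin (d ∸ 1))
  ... | no _ = []

  _≟V_ : (u v : Vtx d h) → Dec (u ≡ v)
  root ≟V root = yes refl
  root ≟V node _ _ _ _ = no (λ ())
  node _ _ _ _ ≟V root = no (λ ())
  node k _ c p ≟V node k' _ c' p' with k ℕ.≟ k'
  ... | no k≢k' = no (λ { refl → k≢k' refl })
  ... | yes refl with c Fin.≟ c'
  ...   | no c≢c' = no (λ { refl → c≢c' refl })
  ...   | yes refl with VecP.≡-dec Fin._≟_ p p'
  ...     | no p≢p' = no (λ { refl → p≢p' refl })
  ...     | yes refl = yes refl

allVecs : (m n : ℕ) → List (Vec (Fin m) n)
allVecs m zero = [] ∷ []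
allVecs m (suc n) = concatMap (λ a → map (a ∷_) (allVecs m n)) (allFin m)

-- enumeration of the vertex set V (each vertex exactly once)
allV : (d h : ℕ) → List (Vtx d h)
allV d h = root ∷ concatMap (λ (k : Fin h) →
             concatMap (λ c → map (node (toℕ k) (toℕ<n k) c) (allVecs (d ∸ 1) (toℕ k)))
                       (allFin d))
           (allFin h)

ZV : (d h : ℕ) → Set
ZV d h = Vtx d h → ℤ

module _ {d h : ℕ} where

  𝐱 : Vtx d h → ZV d h
  𝐱 i u with i ≟V u
  ... | yes _ = + 1
  ... | no _ = + 0

  infixl 6 _+V_ _-V_
  infixl 7 _·V_

  _+V_ : ZV d h → ZV d h → ZV d h
  (v +V w) u = v u ℤ.+ w u

  _-V_ : ZV d h → ZV d h → ZV d h
  (v -V w) u = v u ℤ.- w u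

  _·V_ : ℤ → ZV d h → ZV d h
  (m ·V v) u = m ℤ.* v u

  0V : ZV d h
  0V u = + 0

  sumV : List (ZV d h) → ZV d h
  sumV = List.foldr _+V_ 0V

  δ : Vtx d h → ZV d h
  δ i = ((+ d ·V 𝐱 i) -V parentTerm (parent i)) -V sumV (map 𝐱 (children i))
    where
    parentTerm : Maybe (Vtx d h) → ZV d h
    parentTerm nothing = 0V
    parentTerm (just q) = 𝐱 q

InRelations : (d h : ℕ) → ZV d h → Set
InRelations d h v =
  Σ (Vtx d h → ℤ) λ c → ∀ u → v u ≡ sumV (map (λ i → c i ·V δ i) (allV d h)) u

-- v̄ = w̄ in G(d,h) = ℤ^V / Σ ℤ δ_i
_≈G_ : {d h : ℕ} → ZV d h → ZV d h → Set
_≈G_ {d} {h} v w = InRelations d h (v -V w)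

IsOrderIn : (d h : ℕ) → ZV d h → ℕ → Set
IsOrderIn d h v o =
  0 < o × InRelations d h (+ o ·V v)
        × (∀ m → 0 < m → InRelations d h (+ m ·V v) → o ≤ m)

-- θ(d,m) = ((d-1)^m - 1)/(d-2), for d ≥ 3 (exact division)
θ : (d m : ℕ) → 3 ≤ d → ℕ
θ d m 3≤d = ((d ∸ 1) ^ m ∸ 1) / (d ∸ 2)
  where instance
    nz : NonZero (d ∸ 2)
    nz = >-nonZero (∸-monoˡ-≤ 2 3≤d)

{-# OPTIONS --safe #-}
-- Write θ(m) = θ(d,m), |u| for the depth of u, and M = θ(h−n+2). If j has height N (|j| + N = h),
-- then θ(N+2)x_j − θ(N+1)x_{p(j)} is a relation: it is θ(N+1)δ_j plus the same relations for
-- the children of j, because θ(N+2) = dθ(N+1) − (d−1)θ(N). For siblings j₁, j₂ the parent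
-- terms cancel, so M annihilates x̄_{j₁} − x̄_{j₂}.
-- Conversely, let D : V → ℤ sum to zero over every set of siblings, and let f(u) be
-- θ(h+1−|u|)·D(ancestor of u at depth n) if |u| ≥ n and 0 otherwise. The same recurrence (and,
-- one level above n, the balance of D) makes ⟨δ_i, f⟩ vanish unless |i| = n, where it is M·D(i);
-- so M divides ⟨v, f⟩ for every relation v. From m(x̄_{j₁} − x̄_{j₂}) = 0 we get
-- M ∣ m·θ(h−n+1)·(D(j₁) − D(j₂)). Taking D = x_{j₁} − x_{j₂} if d = 3, and D = x_{j₁} − x_s for a
-- third sibling s if d ≥ 4, gives M ∣ m(d−1)θ(h−n+1) = m(M − 1), hence M ∣ m.
module Submission where

open import Defs
open import Data.Nat as ℕ using (ℕ; zero; suc; _≤_; _<_; _∸_; z≤n; s≤s; _<?_; _≤?_)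
import Data.Nat.Properties as ℕₚ
open import Data.Nat.DivMod using (m*n/n≡m)
import Data.Nat.Solver as ℕ-Solver
open import Data.Nat.Divisibility using () renaming (∣⇒≤ to ℕ-∣⇒≤)
open import Data.Integer as ℤ using (ℤ; +_; _+_; _*_; _-_)
import Data.Integer.Properties as ℤₚ
open import Data.Integer.Divisibility.Signed using (_∣_; divides; ∣⇒∣ᵤ; ∣-refl; ∣m∣n⇒∣m+n; ∣m+n∣n⇒∣m; ∣n⇒∣m*n; ∣m⇒∣m*n)
open import Algebra.Properties.Ring ℤₚ.+-*-ring using (x[y-z]≈xy-xz; [y-z]x≈yx-zx)
open import Data.Integer.Solver using (module +-*-Solver)
open import Data.Fin as Fin using (Fin; toℕ)
import Data.Fin.Properties as Finₚ
open import Data.Vec using (Vec; []; _∷_)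
open import Data.Vec.Properties using (∷-injective)
open import Data.List using (List; []; _∷_; map; allFin; concatMap; _++_; tabulate)
open import Data.List.Relation.Unary.All as All using (All; []; _∷_)
open import Data.List.Relation.Unary.All.Properties using (map⁺)
open import Data.Maybe using (Maybe; just; nothing; maybe′)
import Data.Maybe.Properties as Maybeₚ
open import Data.Product using (∃-syntax; _×_; _,_; proj₁; proj₂)
open import Data.Sum using (inj₁; inj₂)
open import Function using (_∘_)
open import Relation.Nullary using (yes; no)
open import Relation.Nullary.Decidable using (recompute)
open import Relation.Nullary.Negation using (contradiction; contradiction-irr)
open import Relation.Binary.Definitions using (tri<; tri≈; tri>)
open import Relation.Binary.PropositionalEquality

private variable
  A B : Set

∑ : (A → ℤ) → List A → ℤ
∑ g []       = + 0
∑ g (x ∷ xs) = g x + ∑ g xs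

∑-++ : (g : A → ℤ) (xs ys : List A) → ∑ g (xs ++ ys) ≡ ∑ g xs + ∑ g ys
∑-++ g []       ys = sym (ℤₚ.+-identityˡ _)
∑-++ g (x ∷ xs) ys = trans (cong (_+_ (g x)) (∑-++ g xs ys)) (sym (ℤₚ.+-assoc (g x) _ _))

∑-concatMap : (g : B → ℤ) (F : A → List B) (xs : List A) →
              ∑ g (concatMap F xs) ≡ ∑ (∑ g ∘ F) xs
∑-concatMap g F []       = refl
∑-concatMap g F (x ∷ xs) = trans (∑-++ g (F x) _) (cong (_+_ (∑ g (F x))) (∑-concatMap g F xs))

∑-map : (g : B → ℤ) (f : A → B) (xs : List A) → ∑ g (map f xs) ≡ ∑ (g ∘ f) xs
∑-map g f []       = refl
∑-map g f (x ∷ xs) = cong (_+_ (g (f x))) (∑-map g f xs)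

∑-cong : {g g′ : A → ℤ} (xs : List A) → (∀ x → g x ≡ g′ x) → ∑ g xs ≡ ∑ g′ xs
∑-cong []       e = refl
∑-cong (x ∷ xs) e = cong₂ _+_ (e x) (∑-cong xs e)

∑-congᴬ : {g g′ : A → ℤ} {xs : List A} → All (λ x → g x ≡ g′ x) xs → ∑ g xs ≡ ∑ g′ xs
∑-congᴬ []       = refl
∑-congᴬ (e ∷ es) = cong₂ _+_ e (∑-congᴬ es)

∑-zero : {g : A → ℤ} (xs : List A) → (∀ x → g x ≡ + 0) → ∑ g xs ≡ + 0
∑-zero []       e = refl
∑-zero (x ∷ xs) e = cong₂ _+_ (e x) (∑-zero xs e)

∑-zeroᴬ : {g : A → ℤ} {xs : List A} → All (λ x → g x ≡ + 0) xs → ∑ g xs ≡ + 0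
∑-zeroᴬ []       = refl
∑-zeroᴬ (e ∷ es) = cong₂ _+_ e (∑-zeroᴬ es)

∑-+ : (g g′ : A → ℤ) (xs : List A) → ∑ (λ x → g x + g′ x) xs ≡ ∑ g xs + ∑ g′ xs
∑-+ g g′ []       = refl
∑-+ g g′ (x ∷ xs) rewrite ∑-+ g g′ xs =
  solve 4 (λ a b c e → (a :+ b) :+ (c :+ e) := (a :+ c) :+ (b :+ e)) refl (g x) (g′ x) (∑ g xs) (∑ g′ xs)
  where open +-*-Solver

∑-*ˡ : (k : ℤ) (g : A → ℤ) (xs : List A) → ∑ (λ x → k * g x) xs ≡ k * ∑ g xs
∑-*ˡ k g []       = sym (ℤₚ.*-zeroʳ k)
∑-*ˡ k g (x ∷ xs) = trans (cong (_+_ (k * g x)) (∑-*ˡ k g xs)) (sym (ℤₚ.*-distribˡ-+ k (g x) _))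

∑-- : (g g′ : A → ℤ) (xs : List A) → ∑ (λ x → g x - g′ x) xs ≡ ∑ g xs - ∑ g′ xs
∑-- g g′ xs = begin
  ∑ (λ x → g x - g′ x) xs            ≡⟨ ∑-cong xs (λ x → cong (_+_ (g x)) (sym (ℤₚ.-1*i≡-i (g′ x)))) ⟩
  ∑ (λ x → g x + ℤ.-1ℤ * g′ x) xs     ≡⟨ ∑-+ g _ xs ⟩
  ∑ g xs + ∑ (λ x → ℤ.-1ℤ * g′ x) xs  ≡⟨ cong (_+_ (∑ g xs)) (trans (∑-*ˡ ℤ.-1ℤ g′ xs) (ℤₚ.-1*i≡-i _)) ⟩
  ∑ g xs - ∑ g′ xs                    ∎
  where open ≡-Reasoning

∑-∣ : ∀ {M} {g : A → ℤ} (xs : List A) → (∀ x → M ∣ g x) → M ∣ ∑ g xs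
∑-∣ []       M∣g = divides (+ 0) refl
∑-∣ (x ∷ xs) M∣g = ∣m∣n⇒∣m+n (M∣g x) (∑-∣ xs M∣g)

∑-tabulate : ∀ {m} (g : A → ℤ) (f : Fin m → A) → ∑ g (tabulate f) ≡ ∑ (g ∘ f) (allFin m)
∑-tabulate {m = zero}  g f = refl
∑-tabulate {m = suc m} g f =
  cong (_+_ (g (f Fin.zero))) (trans (∑-tabulate g (f ∘ Fin.suc)) (sym (∑-tabulate (g ∘ f) Fin.suc)))

∑-allFin-single : ∀ {m} (g : Fin m → ℤ) (a : Fin m) → (∀ a′ → a′ ≢ a → g a′ ≡ + 0) →
                  ∑ g (allFin m) ≡ g a
∑-allFin-single {suc m} g Fin.zero e = begin
  g Fin.zero + ∑ g (tabulate (Fin.suc {m}))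
    ≡⟨ cong (_+_ (g Fin.zero)) (∑-tabulate g Fin.suc) ⟩
  g Fin.zero + ∑ (g ∘ Fin.suc) (allFin m)
    ≡⟨ cong (_+_ (g Fin.zero)) (∑-zero (allFin m) (λ a′ → e (Fin.suc a′) λ ())) ⟩
  g Fin.zero + + 0
    ≡⟨ ℤₚ.+-identityʳ _ ⟩
  g Fin.zero ∎
  where open ≡-Reasoning
∑-allFin-single {suc m} g (Fin.suc a) e = begin
  g Fin.zero + ∑ g (tabulate (Fin.suc {m}))
    ≡⟨ cong₂ _+_ (e Fin.zero λ ()) (∑-tabulate g Fin.suc) ⟩
  + 0 + ∑ (g ∘ Fin.suc) (allFin m)
    ≡⟨ ℤₚ.+-identityˡ _ ⟩
  ∑ (g ∘ Fin.suc) (allFin m)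
    ≡⟨ ∑-allFin-single (g ∘ Fin.suc) a (λ a′ a′≢a → e (Fin.suc a′) (a′≢a ∘ Finₚ.suc-injective)) ⟩
  g (Fin.suc a) ∎
  where open ≡-Reasoning

∑-allFin-const : ∀ m (x : ℤ) → ∑ (λ _ → x) (allFin m) ≡ + m * x
∑-allFin-const zero    x = refl
∑-allFin-const (suc m) x = begin
  x + ∑ (λ _ → x) (tabulate (Fin.suc {m}))
    ≡⟨ cong (_+_ x) (trans (∑-tabulate (λ _ → x) (Fin.suc {m})) (∑-allFin-const m x)) ⟩
  x + + m * x
    ≡⟨ solve 2 (λ x m → x :+ m :* x := (con (+ 1) :+ m) :* x) refl x (+ m) ⟩
  + suc m * x ∎
  where
  open ≡-Reasoning
  open +-*-Solver

∑-allVecs-single : ∀ {m} k (g : Vec (Fin m) k → ℤ) (p : Vec (Fin m) k) → (∀ v → v ≢ p → g v ≡ + 0) →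
                   ∑ g (allVecs m k) ≡ g p
∑-allVecs-single zero    g [] e = ℤₚ.+-identityʳ (g [])
∑-allVecs-single {m} (suc k) g (a ∷ p) e = begin
  ∑ g (concatMap (λ a′ → map (a′ ∷_) (allVecs m k)) (allFin m))
    ≡⟨ ∑-concatMap g _ (allFin m) ⟩
  ∑ (λ a′ → ∑ g (map (a′ ∷_) (allVecs m k))) (allFin m)
    ≡⟨ ∑-cong (allFin m) (λ a′ → ∑-map g (a′ ∷_) (allVecs m k)) ⟩
  ∑ (λ a′ → ∑ (g ∘ (a′ ∷_)) (allVecs m k)) (allFin m)
    ≡⟨ ∑-allFin-single _ a (λ a′ a′≢a →
         ∑-zero (allVecs m k) (λ v → e (a′ ∷ v) (a′≢a ∘ proj₁ ∘ ∷-injective))) ⟩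
  ∑ (g ∘ (a ∷_)) (allVecs m k)
    ≡⟨ ∑-allVecs-single k (g ∘ (a ∷_)) p (λ v v≢p → e (a ∷ v) (v≢p ∘ proj₂ ∘ ∷-injective)) ⟩
  g (a ∷ p) ∎
  where open ≡-Reasoning

module _ {d h : ℕ} where

  𝐱-≡ : {q u : Vtx d h} → q ≡ u → 𝐱 q u ≡ + 1
  𝐱-≡ {q} {u} q≡u with q ≟V u
  ... | yes _   = refl
  ... | no q≢u = contradiction q≡u q≢u

  𝐱-≢ : {q u : Vtx d h} → q ≢ u → 𝐱 q u ≡ + 0
  𝐱-≢ {q} {u} q≢u with q ≟V u
  ... | yes q≡u = contradiction q≡u q≢u
  ... | no _    = refl

  𝐱-* : (q u : Vtx d h) (g : Vtx d h → ℤ) → 𝐱 q u * g u ≡ 𝐱 q u * g q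
  𝐱-* q u g with q ≟V u
  ... | yes refl = refl
  ... | no _     = refl

  node-injective : ∀ {k} .{lt lt′} {c c′ : Fin d} {p p′ : Vec (Fin (d ∸ 1)) k} →
                   node {d} {h} k lt c p ≡ node k lt′ c′ p′ → c ≡ c′ × p ≡ p′
  node-injective refl = refl , refl

  ∑-𝐱-map-allFin : ∀ {m} (G : Fin m → Vtx d h) (a : Fin m) {q : Vtx d h} → G a ≡ q →
                   (∀ a′ → G a′ ≡ q → a′ ≡ a) → ∑ (𝐱 q) (map G (allFin m)) ≡ + 1
  ∑-𝐱-map-allFin {m} G a Ga≡q unique = begin
    ∑ (𝐱 _) (map G (allFin m)) ≡⟨ ∑-map _ G (allFin m) ⟩
    ∑ (𝐱 _ ∘ G) (allFin m)     ≡⟨ ∑-allFin-single _ a (λ a′ a′≢a → 𝐱-≢ (a′≢a ∘ unique a′ ∘ sym)) ⟩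
    𝐱 _ (G a)                  ≡⟨ 𝐱-≡ (sym Ga≡q) ⟩
    + 1                        ∎
    where open ≡-Reasoning

  layer : (k : ℕ) → .(k < h) → List (Vtx d h)
  layer k lt = concatMap (λ c → map (node k lt c) (allVecs (d ∸ 1) k)) (allFin d)

  ∑-layer : (g : Vtx d h → ℤ) (k : ℕ) .(lt : k < h) →
             ∑ g (layer k lt) ≡ ∑ (λ c → ∑ (g ∘ node k lt c) (allVecs (d ∸ 1) k)) (allFin d)
  ∑-layer g k lt = trans (∑-concatMap g _ (allFin d))
                          (∑-cong (allFin d) (λ c → ∑-map g (node k lt c) (allVecs (d ∸ 1) k)))

  count-layer-≢ : (q : Vtx d h) (k : ℕ) .(lt : k < h) → depth q ≢ suc k → ∑ (𝐱 q) (layer k lt) ≡ + 0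
  count-layer-≢ q k lt depth≢ = trans (∑-layer (𝐱 q) k lt)
    (∑-zero (allFin d) λ c → ∑-zero (allVecs (d ∸ 1) k) λ v → 𝐱-≢ (depth≢ ∘ cong depth))

  count-layer-node : ∀ k .(lt : k < h) c p k′ .(lt′ : k′ < h) → k′ ≡ k →
                      ∑ (𝐱 (node k lt c p)) (layer k′ lt′) ≡ + 1
  count-layer-node k lt c p .k lt′ refl = begin
    ∑ (𝐱 q) (layer k lt′)
      ≡⟨ ∑-layer (𝐱 q) k lt′ ⟩
    ∑ (λ c′ → ∑ (𝐱 q ∘ node k lt′ c′) (allVecs (d ∸ 1) k)) (allFin d)
      ≡⟨ ∑-allFin-single _ c (λ c′ c′≢c →
           ∑-zero (allVecs (d ∸ 1) k) λ v → 𝐱-≢ (c′≢c ∘ sym ∘ proj₁ ∘ node-injective)) ⟩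
    ∑ (𝐱 q ∘ node k lt′ c) (allVecs (d ∸ 1) k)
      ≡⟨ ∑-allVecs-single k _ p (λ v v≢p → 𝐱-≢ (v≢p ∘ sym ∘ proj₂ ∘ node-injective)) ⟩
    𝐱 q q
      ≡⟨ 𝐱-≡ refl ⟩
    + 1 ∎
    where
    open ≡-Reasoning
    q = node k lt c p

  count-allV : (q : Vtx d h) → ∑ (𝐱 q) (allV d h) ≡ + 1
  count-allV root = begin
    𝐱 (root {d} {h}) root + ∑ (𝐱 root) (concatMap levels (allFin h))
      ≡⟨ cong₂ _+_ (𝐱-≡ {q = root} refl) (∑-concatMap (𝐱 root) levels (allFin h)) ⟩
    + 1 + ∑ (∑ (𝐱 root) ∘ levels) (allFin h)
      ≡⟨ cong (_+_ (+ 1)) (∑-zero (allFin h) λ k → count-layer-≢ root (toℕ k) (Finₚ.toℕ<n k) λ ()) ⟩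
    + 1 ∎
    where
    open ≡-Reasoning
    levels = λ (k : Fin h) → layer (toℕ k) (Finₚ.toℕ<n k)
  count-allV q@(node k lt c p) = begin
    𝐱 q root + ∑ (𝐱 q) (concatMap levels (allFin h))
      ≡⟨ cong₂ _+_ (𝐱-≢ {q = q} {root} λ ()) (∑-concatMap (𝐱 q) levels (allFin h)) ⟩
    + 0 + ∑ (∑ (𝐱 q) ∘ levels) (allFin h)
      ≡⟨ ℤₚ.+-identityˡ _ ⟩
    ∑ (∑ (𝐱 q) ∘ levels) (allFin h)
      ≡⟨ ∑-allFin-single _ kₕ (λ k′ k′≢kₕ →
           count-layer-≢ q (toℕ k′) _ (k′≢kₕ ∘ toℕ≡ ∘ ℕₚ.suc-injective ∘ sym)) ⟩
    ∑ (𝐱 q) (levels kₕ)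
      ≡⟨ count-layer-node k lt c p (toℕ kₕ) _ (Finₚ.toℕ-fromℕ< _) ⟩
    + 1 ∎
    where
    open ≡-Reasoning
    levels = λ (k : Fin h) → layer (toℕ k) (Finₚ.toℕ<n k)
    k<h : k < h
    k<h = recompute (k <? h) lt
    kₕ = Fin.fromℕ< k<h
    toℕ≡ : ∀ {k′} → toℕ k′ ≡ k → k′ ≡ kₕ
    toℕ≡ e = Finₚ.toℕ-injective (trans e (sym (Finₚ.toℕ-fromℕ< k<h)))

  ∑-allV-𝐱 : (q : Vtx d h) (g : Vtx d h → ℤ) → ∑ (λ u → 𝐱 q u * g u) (allV d h) ≡ g q
  ∑-allV-𝐱 q g = begin
    ∑ (λ u → 𝐱 q u * g u) (allV d h) ≡⟨ ∑-cong (allV d h) (λ u → trans (𝐱-* q u g) (ℤₚ.*-comm _ (g q))) ⟩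
    ∑ (λ u → g q * 𝐱 q u) (allV d h) ≡⟨ ∑-*ˡ (g q) (𝐱 q) (allV d h) ⟩
    g q * ∑ (𝐱 q) (allV d h)         ≡⟨ cong (g q *_) (count-allV q) ⟩
    g q * + 1                        ≡⟨ ℤₚ.*-identityʳ (g q) ⟩
    g q                              ∎
    where open ≡-Reasoning

  depth-parent : {i q : Vtx d h} → parent i ≡ just q → depth i ≡ suc (depth q)
  depth-parent {node zero    _ _ []}      refl = refl
  depth-parent {node (suc k) _ _ (_ ∷ _)} refl = refl

  depth≤h : (i : Vtx d h) → depth i ≤ h
  depth≤h root           = z≤n
  depth≤h (node k lt _ _) = recompute (k <? h) lt

  parent-children : (i : Vtx d h) → All (λ ch → parent ch ≡ just i) (children i)
  parent-children root with 0 <? h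
  ... | yes _ = map⁺ (All.universal (λ _ → refl) (allFin d))
  ... | no _  = []
  parent-children (node k _ _ _) with suc k <? h
  ... | yes _ = map⁺ (All.universal (λ _ → refl) (allFin (d ∸ 1)))
  ... | no _  = []

  children-leaf : (j : Vtx d h) → depth j ≡ h → children j ≡ []
  children-leaf root dj≡h with 0 <? h
  ... | yes 0<h = contradiction dj≡h (ℕₚ.<⇒≢ 0<h)
  ... | no _    = refl
  children-leaf (node k _ _ _) dj≡h with suc k <? h
  ... | yes k+1<h = contradiction dj≡h (ℕₚ.<⇒≢ k+1<h)
  ... | no _      = refl

  count-children-parent : (q i : Vtx d h) → parent q ≡ just i → ∑ (𝐱 q) (children i) ≡ + 1
  count-children-parent (node zero lt c []) .root refl with 0 <? h
  ... | yes _  = ∑-𝐱-map-allFin _ c refl (λ _ → proj₁ ∘ node-injective)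
  ... | no 0≮h = contradiction-irr lt 0≮h
  count-children-parent (node (suc k) lt c (a ∷ p)) ._ refl with suc k <? h
  ... | yes _   = ∑-𝐱-map-allFin _ a refl (λ _ → proj₁ ∘ ∷-injective ∘ proj₂ ∘ node-injective)
  ... | no 1+k≮h = contradiction-irr lt 1+k≮h

  count-children-¬parent : (q i : Vtx d h) → parent q ≢ just i → ∑ (𝐱 q) (children i) ≡ + 0
  count-children-¬parent q i pq≢i =
    ∑-zeroᴬ (All.map (λ pch≡i → 𝐱-≢ λ { refl → pq≢i pch≡i }) (parent-children i))

  siblings-balanced : {a a′ : Vtx d h} → parent a ≡ parent a′ → ∀ i → ∑ (𝐱 a -V 𝐱 a′) (children i) ≡ + 0
  siblings-balanced {a} {a′} pa≡pa′ i = trans (∑-- (𝐱 a) (𝐱 a′) (children i)) (ℤₚ.i≡j⇒i-j≡0 same-count)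
    where
    same-count : ∑ (𝐱 a) (children i) ≡ ∑ (𝐱 a′) (children i)
    same-count with Maybeₚ.≡-dec _≟V_ (parent a) (just i)
    ... | yes pa≡i = trans (count-children-parent a i pa≡i) (sym (count-children-parent a′ i (trans (sym pa≡pa′) pa≡i)))
    ... | no pa≢i  = trans (count-children-¬parent a i pa≢i) (sym (count-children-¬parent a′ i (pa≢i ∘ trans pa≡pa′)))

  ancestor : ℕ → Vtx d h → Vtx d h
  ancestor zero    u = u
  ancestor (suc r) u = maybe′ (ancestor r) root (parent u)

  ancestor-parent : ∀ r {u q : Vtx d h} → parent u ≡ just q → ancestor (suc r) u ≡ ancestor r q
  ancestor-parent r = cong (maybe′ (ancestor r) root)

  sumV-map : (F : A → ZV d h) (xs : List A) (u : Vtx d h) → sumV (map F xs) u ≡ ∑ (λ x → F x u) xs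
  sumV-map F []       u = refl
  sumV-map F (x ∷ xs) u = cong (_+_ (F x u)) (sumV-map F xs u)

  δ-expand : (i u : Vtx d h) →
             δ i u ≡ (+ d * 𝐱 i u - maybe′ 𝐱 0V (parent i) u) - sumV (map 𝐱 (children i)) u
  δ-expand root                         u = refl
  δ-expand (node zero    _ _ [])      u = refl
  δ-expand (node (suc k) _ _ (_ ∷ _)) u = refl

  InRelations-resp-≗ : {v w : ZV d h} → (∀ u → v u ≡ w u) → InRelations d h v → InRelations d h w
  InRelations-resp-≗ v≗w (c , v≡) = c , λ u → trans (sym (v≗w u)) (v≡ u)

  combination : (Vtx d h → ℤ) → ZV d h
  combination c u = ∑ (λ i → c i * δ i u) (allV d h)

  sumV-combination : (c : Vtx d h → ℤ) (u : Vtx d h) →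
                     sumV (map (λ i → c i ·V δ i) (allV d h)) u ≡ combination c u
  sumV-combination c = sumV-map (λ i → c i ·V δ i) (allV d h)

  InRelations-+ : {v w : ZV d h} → InRelations d h v → InRelations d h w → InRelations d h (v +V w)
  InRelations-+ {v} {w} (c , v≡) (c′ , w≡) = (λ i → c i + c′ i) , λ u → begin
    v u + w u
      ≡⟨ cong₂ _+_ (trans (v≡ u) (sumV-combination c u)) (trans (w≡ u) (sumV-combination c′ u)) ⟩
    combination c u + combination c′ u
      ≡⟨ sym (∑-+ (λ i → c i * δ i u) (λ i → c′ i * δ i u) (allV d h)) ⟩
    ∑ (λ i → c i * δ i u + c′ i * δ i u) (allV d h)
      ≡⟨ ∑-cong (allV d h) (λ i → sym (ℤₚ.*-distribʳ-+ (δ i u) (c i) (c′ i))) ⟩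
    combination (λ i → c i + c′ i) u
      ≡⟨ sym (sumV-combination c″ u) ⟩
    sumV (map (λ i → (c i + c′ i) ·V δ i) (allV d h)) u ∎
    where
    open ≡-Reasoning
    c″ = λ i → c i + c′ i

  InRelations-· : {v : ZV d h} (k : ℤ) → InRelations d h v → InRelations d h (k ·V v)
  InRelations-· {v} k (c , v≡) = (λ i → k * c i) , λ u → begin
    k * v u
      ≡⟨ cong (k *_) (trans (v≡ u) (sumV-combination c u)) ⟩
    k * combination c u
      ≡⟨ sym (∑-*ˡ k (λ i → c i * δ i u) (allV d h)) ⟩
    ∑ (λ i → k * (c i * δ i u)) (allV d h)
      ≡⟨ ∑-cong (allV d h) (λ i → sym (ℤₚ.*-assoc k (c i) (δ i u))) ⟩
    combination (λ i → k * c i) u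
      ≡⟨ sym (sumV-combination c″ u) ⟩
    sumV (map (λ i → (k * c i) ·V δ i) (allV d h)) u ∎
    where
    open ≡-Reasoning
    c″ = λ i → k * c i

  InRelations-0 : InRelations d h 0V
  InRelations-0 = (λ _ → + 0) , λ u → sym (trans (sumV-combination (λ _ → + 0) u) (∑-zero (allV d h) λ _ → refl))

  InRelations-δ : (q : Vtx d h) → InRelations d h (δ q)
  InRelations-δ q = 𝐱 q , λ u → sym (trans (sumV-combination (𝐱 q) u) (∑-allV-𝐱 q (λ i → δ i u)))

  InRelations-sumV : (F : A → ZV d h) {xs : List A} → All (InRelations d h ∘ F) xs →
                     InRelations d h (sumV (map F xs))
  InRelations-sumV F []       = InRelations-0
  InRelations-sumV F (r ∷ rs) = InRelations-+ r (InRelations-sumV F rs)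

  ⟪_,_⟫ : ZV d h → (Vtx d h → ℤ) → ℤ
  ⟪ v , g ⟫ = ∑ (λ u → v u * g u) (allV d h)

  module _ (g : Vtx d h → ℤ) where

    pairing-resp-≗ : {v w : ZV d h} → (∀ u → v u ≡ w u) → ⟪ v , g ⟫ ≡ ⟪ w , g ⟫
    pairing-resp-≗ v≗w = ∑-cong (allV d h) (λ u → cong (_* g u) (v≗w u))

    pairing-𝐱 : (q : Vtx d h) → ⟪ 𝐱 q , g ⟫ ≡ g q
    pairing-𝐱 q = ∑-allV-𝐱 q g

    pairing-0 : ⟪ 0V , g ⟫ ≡ + 0
    pairing-0 = ∑-zero (allV d h) λ _ → refl

    pairing-+ : (v w : ZV d h) → ⟪ v +V w , g ⟫ ≡ ⟪ v , g ⟫ + ⟪ w , g ⟫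
    pairing-+ v w = trans (∑-cong (allV d h) λ u → ℤₚ.*-distribʳ-+ (g u) (v u) (w u))
                          (∑-+ (λ u → v u * g u) (λ u → w u * g u) (allV d h))

    pairing-- : (v w : ZV d h) → ⟪ v -V w , g ⟫ ≡ ⟪ v , g ⟫ - ⟪ w , g ⟫
    pairing-- v w = trans (∑-cong (allV d h) λ u → [y-z]x≈yx-zx (g u) (v u) (w u))
                          (∑-- (λ u → v u * g u) (λ u → w u * g u) (allV d h))

    pairing-· : (k : ℤ) (v : ZV d h) → ⟪ k ·V v , g ⟫ ≡ k * ⟪ v , g ⟫
    pairing-· k v = trans (∑-cong (allV d h) λ u → ℤₚ.*-assoc k (v u) (g u))
                          (∑-*ˡ k (λ u → v u * g u) (allV d h))

    pairing-sumV : (F : A → ZV d h) (xs : List A) → ⟪ sumV (map F xs) , g ⟫ ≡ ∑ (λ x → ⟪ F x , g ⟫) xs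
    pairing-sumV F []       = pairing-0
    pairing-sumV F (x ∷ xs) = trans (pairing-+ (F x) _) (cong (_+_ ⟪ F x , g ⟫) (pairing-sumV F xs))

    pairing-𝐱ᵐ : (m : Maybe (Vtx d h)) → ⟪ maybe′ 𝐱 0V m , g ⟫ ≡ maybe′ g (+ 0) m
    pairing-𝐱ᵐ nothing  = pairing-0
    pairing-𝐱ᵐ (just q) = pairing-𝐱 q

    pairing-δ : (i : Vtx d h) →
                ⟪ δ i , g ⟫ ≡ (+ d * g i - maybe′ g (+ 0) (parent i)) - ∑ g (children i)
    pairing-δ i = begin
      ⟪ δ i , g ⟫
        ≡⟨ pairing-resp-≗ {v = δ i} (δ-expand i) ⟩
      ⟪ (+ d ·V 𝐱 i -V maybe′ 𝐱 0V (parent i)) -V sumV (map 𝐱 (children i)) , g ⟫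
        ≡⟨ pairing-- (+ d ·V 𝐱 i -V maybe′ 𝐱 0V (parent i)) (sumV (map 𝐱 (children i))) ⟩
      ⟪ + d ·V 𝐱 i -V maybe′ 𝐱 0V (parent i) , g ⟫ - ⟪ sumV (map 𝐱 (children i)) , g ⟫
        ≡⟨ cong₂ _-_ (pairing-- (+ d ·V 𝐱 i) (maybe′ 𝐱 0V (parent i))) (pairing-sumV 𝐱 (children i)) ⟩
      (⟪ + d ·V 𝐱 i , g ⟫ - ⟪ maybe′ 𝐱 0V (parent i) , g ⟫) - ∑ (λ ch → ⟪ 𝐱 ch , g ⟫) (children i)
        ≡⟨ cong₂ _-_ (cong₂ _-_ (trans (pairing-· (+ d) (𝐱 i)) (cong (+ d *_) (pairing-𝐱 i)))
                                (pairing-𝐱ᵐ (parent i)))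
                     (∑-cong (children i) pairing-𝐱) ⟩
      (+ d * g i - maybe′ g (+ 0) (parent i)) - ∑ g (children i) ∎
      where open ≡-Reasoning

    pairing-InRelations : (M : ℤ) → (∀ i → M ∣ ⟪ δ i , g ⟫) →
                          {v : ZV d h} → InRelations d h v → M ∣ ⟪ v , g ⟫
    pairing-InRelations M M∣δ {v} (c , v≡) =
      subst (M ∣_) (sym (trans (pairing-resp-≗ {v = v} v≡) (pairing-sumV (λ i → c i ·V δ i) (allV d h))))
            (∑-∣ (allV d h) λ i → subst (M ∣_) (sym (pairing-· (c i) (δ i))) (∣n⇒∣m*n (c i) (M∣δ i)))

-- repunit b m = 1 + b + ⋯ + b^(m−1) = θ(b+1, m). From here on d = suc b, so that every
-- non-root, non-leaf vertex has exactly b children.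
repunit : ℕ → ℕ → ℕ
repunit b zero    = 0
repunit b (suc m) = 1 ℕ.+ b ℕ.* repunit b m

suc^≡1+repunit* : ∀ b m → suc b ℕ.^ m ≡ 1 ℕ.+ repunit (suc b) m ℕ.* b
suc^≡1+repunit* b zero    = refl
suc^≡1+repunit* b (suc m) rewrite suc^≡1+repunit* b m =
  solve 2 (λ b r → (con 1 :+ b) :* (con 1 :+ r :* b) := con 1 :+ (con 1 :+ (con 1 :+ b) :* r) :* b)
        refl b (repunit (suc b) m)
  where open ℕ-Solver.+-*-Solver

θ≡repunit : ∀ b m (3≤d : 3 ≤ suc b) → θ (suc b) m 3≤d ≡ repunit b m
θ≡repunit (suc (suc b)) m (s≤s (s≤s (s≤s z≤n))) = begin
  (suc (suc b) ℕ.^ m ∸ 1) ℕ./ suc b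
    ≡⟨ cong (λ x → (x ∸ 1) ℕ./ suc b) (suc^≡1+repunit* (suc b) m) ⟩
  repunit (suc (suc b)) m ℕ.* suc b ℕ./ suc b
    ≡⟨ m*n/n≡m (repunit (suc (suc b)) m) (suc b) ⟩
  repunit (suc (suc b)) m ∎
  where open ≡-Reasoning

repunit-sucℤ : ∀ b m → + repunit b (suc m) ≡ + 1 + + b * + repunit b m
repunit-sucℤ b m = trans (ℤₚ.pos-+ 1 _) (cong (_+_ (+ 1)) (ℤₚ.pos-* b (repunit b m)))

second-order-step : ∀ {x y z} (b : ℤ) → x ≡ + 1 + b * y → y ≡ + 1 + b * z → x ≡ y * (+ 1 + b) - b * z
second-order-step {z = z} b refl refl =
  solve 2 (λ b z → con (+ 1) :+ b :* (con (+ 1) :+ b :* z)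
                   := (con (+ 1) :+ b :* z) :* (con (+ 1) :+ b) :- b :* z) refl b z
  where open +-*-Solver

module _ {b h : ℕ} where

  ∑-children-node : {g : Vtx (suc b) h → ℤ} {x : ℤ} (k : ℕ) .(lt : k < h) (c : Fin (suc b)) (p : Vec (Fin b) k) →
                    (∀ ch → parent ch ≡ just (node k lt c p) → g ch ≡ x) → (suc k ≡ h → x ≡ + 0) →
                    ∑ g (children (node k lt c p)) ≡ + b * x
  ∑-children-node {g} {x} k lt c p gch≡x leaf with suc k <? h
  ... | yes _ = begin
    ∑ g (map _ (allFin b))   ≡⟨ ∑-map g _ (allFin b) ⟩
    ∑ (g ∘ _) (allFin b)     ≡⟨ ∑-cong (allFin b) (λ _ → gch≡x _ refl) ⟩
    ∑ (λ _ → x) (allFin b)   ≡⟨ ∑-allFin-const b x ⟩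
    + b * x                  ∎
    where open ≡-Reasoning
  ... | no k+1≮h = sym (trans (cong (+ b *_) (leaf (ℕₚ.≤-antisym (recompute (k <? h) lt) (ℕₚ.≮⇒≥ k+1≮h))))
                               (ℤₚ.*-zeroʳ (+ b)))

  edge-relator : ℕ → Vtx (suc b) h → ZV (suc b) h
  edge-relator N j = (+ repunit b (suc N) ·V 𝐱 j) -V (+ repunit b N ·V maybe′ 𝐱 0V (parent j))

  -- The children's parent terms add up to (d−1)θ(N)x_j, and θ(N+1)d − (d−1)θ(N) = θ(N+2).
  edge-relator-telescopes : ∀ N (j : Vtx (suc b) h) → 0 < depth j → depth j ℕ.+ N ≡ h → ∀ u →
    (+ repunit b (suc N) ·V δ j +V sumV (map (edge-relator N) (children j))) u ≡ edge-relator (suc N) j u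
  edge-relator-telescopes N root () _ u
  edge-relator-telescopes N j@(node k lt c p) _ dj+N≡h u = begin
    α * δ j u + sumV (map (edge-relator N) (children j)) u
      ≡⟨ cong₂ (λ δju s → α * δju + s) (trans (δ-expand j u) (cong (_-_ (+ suc b * x - P)) (sumV-map 𝐱 (children j) u)))
                                         (sumV-map (edge-relator N) (children j) u) ⟩
    α * ((+ suc b * x - P) - S) + ∑ (λ ch → α * 𝐱 ch u - β * maybe′ 𝐱 0V (parent ch) u) (children j)
      ≡⟨ cong (_+_ (α * ((+ suc b * x - P) - S)))
              (trans (∑-- _ _ (children j)) (cong₂ _-_ (∑-*ˡ α (λ ch → 𝐱 ch u) (children j)) parent-terms)) ⟩
    α * ((+ suc b * x - P) - S) + (α * S - + b * (β * x))
      ≡⟨ collect α β (+ b) x P S ⟩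
    (α * (+ 1 + + b) - + b * β) * x - α * P
      ≡⟨ cong (λ C → C * x - α * P) (sym (second-order-step (+ b) (repunit-sucℤ b (suc N)) (repunit-sucℤ b N))) ⟩
    edge-relator (suc N) j u ∎
    where
    open ≡-Reasoning
    α = + repunit b (suc N)
    β = + repunit b N
    x = 𝐱 j u
    P = maybe′ 𝐱 0V (parent j) u
    S = ∑ (λ ch → 𝐱 ch u) (children j)
    parent-terms : ∑ (λ ch → β * maybe′ 𝐱 0V (parent ch) u) (children j) ≡ + b * (β * x)
    parent-terms = ∑-children-node k lt c p (λ ch pch≡j → cong (λ m → β * maybe′ 𝐱 0V m u) pch≡j)
      (λ k+1≡h → cong (λ N → + repunit b N * x)
                      (ℕₚ.+-cancelˡ-≡ (suc k) N 0 (trans dj+N≡h (trans (sym k+1≡h) (sym (ℕₚ.+-identityʳ (suc k)))))))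
    collect : ∀ A B b x P S → A * ((+ 1 + b) * x - P - S) + (A * S - b * (B * x)) ≡ (A * (+ 1 + b) - b * B) * x - A * P
    collect = solve 6 (λ A B b x P S → A :* ((con (+ 1) :+ b) :* x :- P :- S) :+ (A :* S :- b :* (B :* x))
                                       := (A :* (con (+ 1) :+ b) :- b :* B) :* x :- A :* P) refl
      where open +-*-Solver

  InRelations-edge-relator : ∀ N (j : Vtx (suc b) h) → 0 < depth j → depth j ℕ.+ N ≡ h →
                     InRelations (suc b) h (edge-relator (suc N) j)
  InRelations-edge-relator N j 0<dj dj+N≡h =
    InRelations-resp-≗ (edge-relator-telescopes N j 0<dj dj+N≡h)
      (InRelations-+ (InRelations-· (+ repunit b (suc N)) (InRelations-δ j))
                     (InRelations-sumV (edge-relator N) (children-relators N dj+N≡h)))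
    where
    children-relators : ∀ N → depth j ℕ.+ N ≡ h → All (InRelations (suc b) h ∘ edge-relator N) (children j)
    children-relators zero    dj+0≡h = subst (All _) (sym (children-leaf j (trans (sym (ℕₚ.+-identityʳ _)) dj+0≡h))) []
    children-relators (suc N) dj+N+1≡h = All.map (λ {ch} pch≡j →
        InRelations-edge-relator N ch (subst (0 <_) (sym (depth-parent pch≡j)) (s≤s z≤n))
          (trans (cong (ℕ._+ N) (depth-parent pch≡j)) (trans (sym (ℕₚ.+-suc (depth j) N)) dj+N+1≡h)))
      (parent-children j)

module Weight (b h : ℕ) where

  weight : ℕ → ℤ
  weight t = + repunit b (suc h ∸ t)

  weight-≤h : ∀ t → t ≤ h → weight t ≡ + repunit b (suc (h ∸ t))
  weight-≤h t t≤h = cong (+_ ∘ repunit b) (ℕₚ.+-∸-assoc 1 t≤h)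

  weight-pred : ∀ t → t ≤ h → weight t ≡ + 1 + + b * weight (suc t)
  weight-pred t t≤h = trans (weight-≤h t t≤h) (repunit-sucℤ b (h ∸ t))

  weight-step : ∀ t → suc t ≤ h → weight t ≡ weight (suc t) * (+ 1 + + b) - + b * weight (suc (suc t))
  weight-step t t<h = second-order-step (+ b) (weight-pred t (ℕₚ.<⇒≤ t<h)) (weight-pred (suc t) t<h)

  weight-beyond : weight (suc h) ≡ + 0
  weight-beyond = cong (+_ ∘ repunit b) (ℕₚ.n∸n≡0 h)

module Potential {b h : ℕ} (n : ℕ) (D : Vtx (suc b) h → ℤ) where

  open Weight b h

  σ : Vtx (suc b) h → ℤ
  σ u = D (ancestor (depth u ∸ n) u)

  σ-level : {u : Vtx (suc b) h} → depth u ≡ n → σ u ≡ D u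
  σ-level {u} du≡n = cong (λ r → D (ancestor r u)) (trans (cong (_∸ n) du≡n) (ℕₚ.n∸n≡0 n))

  σ-parent : {ch i : Vtx (suc b) h} → parent ch ≡ just i → n ≤ depth i → σ ch ≡ σ i
  σ-parent {ch} {i} pch≡i n≤di =
    trans (cong (λ r → D (ancestor r ch)) (trans (cong (_∸ n) (depth-parent pch≡i)) (ℕₚ.+-∸-assoc 1 n≤di)))
          (cong D (ancestor-parent (depth i ∸ n) pch≡i))

  f : Vtx (suc b) h → ℤ
  f u with n ≤? depth u
  ... | yes _ = weight (depth u) * σ u
  ... | no _  = + 0

  f-below : (u : Vtx (suc b) h) → depth u < n → f u ≡ + 0
  f-below u du<n with n ≤? depth u
  ... | yes n≤du = contradiction n≤du (ℕₚ.<⇒≱ du<n)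
  ... | no _     = refl

  f-above : (u : Vtx (suc b) h) → n ≤ depth u → f u ≡ weight (depth u) * σ u
  f-above u n≤du with n ≤? depth u
  ... | yes _    = refl
  ... | no n≰du = contradiction n≤du n≰du

  f-level : (u : Vtx (suc b) h) → depth u ≡ n → f u ≡ weight n * D u
  f-level u du≡n = trans (f-above u (ℕₚ.≤-reflexive (sym du≡n))) (cong₂ _*_ (cong weight du≡n) (σ-level du≡n))

  f-parent-below : (i : Vtx (suc b) h) → depth i ≤ n → maybe′ f (+ 0) (parent i) ≡ + 0
  f-parent-below i di≤n with parent i in pi≡q
  ... | nothing = refl
  ... | just q  = f-below q (subst (_≤ n) (depth-parent pi≡q) di≤n)

  ∑-f-children-below : (∀ i → ∑ D (children i) ≡ + 0) → ∀ i → depth i < n → ∑ f (children i) ≡ + 0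
  ∑-f-children-below balanced i di<n with ℕₚ.m≤n⇒m<n∨m≡n di<n
  ... | inj₁ di+1<n = ∑-zeroᴬ (All.map (λ pch≡i → f-below _ (subst (_< n) (sym (depth-parent pch≡i)) di+1<n))
                                       (parent-children i))
  ... | inj₂ di+1≡n = begin
    ∑ f (children i)
      ≡⟨ ∑-congᴬ (All.map (λ pch≡i → f-level _ (trans (depth-parent pch≡i) di+1≡n)) (parent-children i)) ⟩
    ∑ (λ ch → weight n * D ch) (children i)
      ≡⟨ ∑-*ˡ (weight n) D (children i) ⟩
    weight n * ∑ D (children i)
      ≡⟨ cong (weight n *_) (balanced i) ⟩
    weight n * + 0
      ≡⟨ ℤₚ.*-zeroʳ (weight n) ⟩
    + 0 ∎
    where open ≡-Reasoning

  ∑-f-children-above : ∀ k .(lt : k < h) c p → n ≤ suc k →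
    ∑ f (children (node k lt c p)) ≡ + b * (weight (suc (suc k)) * σ (node k lt c p))
  ∑-f-children-above k lt c p n≤k+1 = ∑-children-node k lt c p
    (λ ch pch≡i → trans (f-above ch (subst (n ≤_) (sym (depth-parent pch≡i)) (ℕₚ.m≤n⇒m≤1+n n≤k+1)))
                        (cong₂ _*_ (cong weight (depth-parent pch≡i)) (σ-parent pch≡i n≤k+1)))
    (λ k+1≡h → trans (cong (λ t → weight (suc t) * σ (node k lt c p)) k+1≡h)
                     (cong (_* σ (node k lt c p)) weight-beyond))

  module _ (balanced : ∀ i → ∑ D (children i) ≡ + 0) (1≤n : 1 ≤ n) where

    pairing-δ-below : ∀ i → depth i < n → ⟪ δ i , f ⟫ ≡ + 0
    pairing-δ-below i di<n = begin
      ⟪ δ i , f ⟫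
        ≡⟨ pairing-δ f i ⟩
      (+ suc b * f i - maybe′ f (+ 0) (parent i)) - ∑ f (children i)
        ≡⟨ cong₂ _-_ (cong₂ _-_ (cong (+ suc b *_) (f-below i di<n)) (f-parent-below i (ℕₚ.<⇒≤ di<n)))
                     (∑-f-children-below balanced i di<n) ⟩
      (+ suc b * + 0 - + 0) - + 0
        ≡⟨ cong (λ z → z - + 0 - + 0) (ℤₚ.*-zeroʳ (+ suc b)) ⟩
      + 0 ∎
      where open ≡-Reasoning

    pairing-δ-level : ∀ i → depth i ≡ n → ⟪ δ i , f ⟫ ≡ weight (n ∸ 1) * D i
    pairing-δ-level root 0≡n = contradiction (subst (1 ≤_) (sym 0≡n) 1≤n) λ ()
    pairing-δ-level i@(node k lt c p) k+1≡n = begin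
      ⟪ δ i , f ⟫
        ≡⟨ pairing-δ f i ⟩
      (+ suc b * f i - maybe′ f (+ 0) (parent i)) - ∑ f (children i)
        ≡⟨ cong₂ _-_ (cong₂ _-_ (cong (+ suc b *_) f-i) (f-parent-below i (ℕₚ.≤-reflexive k+1≡n)))
                     (trans (∑-f-children-above k lt c p n≤k+1) (cong (λ s → + b * (w₂ * s)) (σ-level k+1≡n))) ⟩
      (+ suc b * (w₁ * D i) - + 0) - + b * (w₂ * D i)
        ≡⟨ collect w₁ w₂ (+ b) (D i) ⟩
      (w₁ * (+ 1 + + b) - + b * w₂) * D i
        ≡⟨ cong (_* D i) (sym (weight-step k (depth≤h i))) ⟩
      weight k * D i
        ≡⟨ cong (λ t → weight (t ∸ 1) * D i) k+1≡n ⟩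
      weight (n ∸ 1) * D i ∎
      where
      open ≡-Reasoning
      w₁ = weight (suc k)
      w₂ = weight (suc (suc k))
      n≤k+1 = ℕₚ.≤-reflexive (sym k+1≡n)
      f-i : f i ≡ w₁ * D i
      f-i = trans (f-above i n≤k+1) (cong (w₁ *_) (σ-level k+1≡n))
      collect : ∀ w₁ w₂ b s → ((+ 1 + b) * (w₁ * s) - + 0) - b * (w₂ * s) ≡ (w₁ * (+ 1 + b) - b * w₂) * s
      collect = solve 4 (λ w₁ w₂ b s → ((con (+ 1) :+ b) :* (w₁ :* s) :- con (+ 0)) :- b :* (w₂ :* s)
                                       := (w₁ :* (con (+ 1) :+ b) :- b :* w₂) :* s) refl
        where open +-*-Solver

    pairing-δ-above : ∀ i → n < depth i → ⟪ δ i , f ⟫ ≡ + 0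
    pairing-δ-above (node zero _ _ []) n<1 = contradiction 1≤n (ℕₚ.<⇒≱ n<1)
    pairing-δ-above i@(node (suc k) lt c (a ∷ p)) n<k+2 = begin
      ⟪ δ i , f ⟫
        ≡⟨ pairing-δ f i ⟩
      (+ suc b * f i - f q) - ∑ f (children i)
        ≡⟨ cong₂ _-_ (cong₂ _-_ (cong (+ suc b *_) (f-above i (ℕₚ.<⇒≤ n<k+2))) f-q)
                     (∑-f-children-above (suc k) lt c (a ∷ p) (ℕₚ.<⇒≤ n<k+2)) ⟩
      (+ suc b * (w₁ * σ i) - w₀ * σ i) - + b * (w₂ * σ i)
        ≡⟨ cong (λ w → (+ suc b * (w₁ * σ i) - w * σ i) - + b * (w₂ * σ i)) (weight-step (suc k) (depth≤h i)) ⟩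
      (+ suc b * (w₁ * σ i) - (w₁ * (+ 1 + + b) - + b * w₂) * σ i) - + b * (w₂ * σ i)
        ≡⟨ cancel w₁ w₂ (+ b) (σ i) ⟩
      + 0 ∎
      where
      open ≡-Reasoning
      w₀ = weight (suc k)
      w₁ = weight (suc (suc k))
      w₂ = weight (suc (suc (suc k)))
      q = node k (ℕₚ.<-trans (ℕₚ.n<1+n k) lt) c p
      f-q : f q ≡ w₀ * σ i
      f-q = trans (f-above q (ℕₚ.≤-pred n<k+2)) (cong (w₀ *_) (sym (σ-parent {i} refl (ℕₚ.≤-pred n<k+2))))
      cancel : ∀ w₁ w₂ b s → ((+ 1 + b) * (w₁ * s) - (w₁ * (+ 1 + b) - b * w₂) * s) - b * (w₂ * s) ≡ + 0
      cancel = solve 4 (λ w₁ w₂ b s → ((con (+ 1) :+ b) :* (w₁ :* s) :- (w₁ :* (con (+ 1) :+ b) :- b :* w₂) :* s)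
                                       :- b :* (w₂ :* s) := con (+ 0)) refl
        where open +-*-Solver

    weight∣pairing-δ : ∀ i → weight (n ∸ 1) ∣ ⟪ δ i , f ⟫
    weight∣pairing-δ i with ℕₚ.<-cmp (depth i) n
    ... | tri< di<n _ _ = subst (_ ∣_) (sym (pairing-δ-below i di<n)) (divides (+ 0) refl)
    ... | tri≈ _ di≡n _ = subst (_ ∣_) (sym (pairing-δ-level i di≡n)) (∣m⇒∣m*n (D i) ∣-refl)
    ... | tri> _ _ n<di = subst (_ ∣_) (sym (pairing-δ-above i n<di)) (divides (+ 0) refl)

    level-difference-∣ : {j₁ j₂ : Vtx (suc b) h} → depth j₁ ≡ n → depth j₂ ≡ n → (m : ℤ) →
                         InRelations (suc b) h (m ·V (𝐱 j₁ -V 𝐱 j₂)) →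
                         weight (n ∸ 1) ∣ m * (weight n * (D j₁ - D j₂))
    level-difference-∣ {j₁} {j₂} dj₁≡n dj₂≡n m rel =
      subst (_ ∣_) pairing-difference (pairing-InRelations f (weight (n ∸ 1)) weight∣pairing-δ rel)
      where
      open ≡-Reasoning
      pairing-difference : ⟪ m ·V (𝐱 j₁ -V 𝐱 j₂) , f ⟫ ≡ m * (weight n * (D j₁ - D j₂))
      pairing-difference = begin
        ⟪ m ·V (𝐱 j₁ -V 𝐱 j₂) , f ⟫
          ≡⟨ pairing-· f m (𝐱 j₁ -V 𝐱 j₂) ⟩
        m * ⟪ 𝐱 j₁ -V 𝐱 j₂ , f ⟫
          ≡⟨ cong (m *_) (pairing-- f (𝐱 j₁) (𝐱 j₂)) ⟩
        m * (⟪ 𝐱 j₁ , f ⟫ - ⟪ 𝐱 j₂ , f ⟫)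
          ≡⟨ cong (m *_) (cong₂ _-_ (pairing-𝐱 f j₁) (pairing-𝐱 f j₂)) ⟩
        m * (f j₁ - f j₂)
          ≡⟨ cong (m *_) (cong₂ _-_ (f-level j₁ dj₁≡n) (f-level j₂ dj₂≡n)) ⟩
        m * (weight n * D j₁ - weight n * D j₂)
          ≡⟨ cong (m *_) (sym (x[y-z]≈xy-xz (weight n) (D j₁) (D j₂))) ⟩
        m * (weight n * (D j₁ - D j₂)) ∎

∣-1+ : ∀ {M k : ℤ} (m : ℤ) → M ≡ + 1 + k → M ∣ m * k → M ∣ m
∣-1+ {M} {k} m M≡1+k M∣mk = ∣m+n∣n⇒∣m (subst (M ∣_) m*M≡m+mk (∣n⇒∣m*n m ∣-refl)) M∣mk
  where
  m*M≡m+mk : m * M ≡ m + m * k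
  m*M≡m+mk = trans (cong (m *_) M≡1+k) (solve 2 (λ m k → m :* (con (+ 1) :+ k) := m :+ m :* k) refl m k)
    where open +-*-Solver

fresh₂ : ∀ {m} → 3 ≤ m → (x y : Fin m) → ∃[ z ] z ≢ x × z ≢ y
fresh₂ (s≤s (s≤s (s≤s _))) Fin.zero           Fin.zero           = Fin.suc Fin.zero , (λ ()) , (λ ())
fresh₂ (s≤s (s≤s (s≤s _))) Fin.zero           (Fin.suc Fin.zero) = Fin.suc (Fin.suc Fin.zero) , (λ ()) , (λ ())
fresh₂ (s≤s (s≤s (s≤s _))) Fin.zero           (Fin.suc (Fin.suc _)) = Fin.suc Fin.zero , (λ ()) , (λ ())
fresh₂ (s≤s (s≤s (s≤s _))) (Fin.suc Fin.zero) Fin.zero           = Fin.suc (Fin.suc Fin.zero) , (λ ()) , (λ ())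
fresh₂ (s≤s (s≤s (s≤s _))) (Fin.suc (Fin.suc _)) Fin.zero        = Fin.suc Fin.zero , (λ ()) , (λ ())
fresh₂ (s≤s (s≤s (s≤s _))) (Fin.suc _)        (Fin.suc _)        = Fin.zero , (λ ()) , (λ ())

module _ {b h : ℕ} where

  -- The child choice leading from the parent to a vertex (a default elsewhere): it separates siblings.
  rootChoice : Fin (suc b) → Vtx (suc b) h → Fin (suc b)
  rootChoice _ (node zero _ c []) = c
  rootChoice c _                  = c

  lastChoice : Fin b → Vtx (suc b) h → Fin b
  lastChoice _ (node (suc _) _ _ (a ∷ _)) = a
  lastChoice a _                          = a

  third-sibling : 3 ≤ b → (j₁ j₂ : Vtx (suc b) h) → 0 < depth j₁ →
                  ∃[ s ] parent s ≡ parent j₁ × s ≢ j₁ × s ≢ j₂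
  third-sibling 3≤b (node zero lt c []) j₂ _ with fresh₂ (ℕₚ.m≤n⇒m≤1+n 3≤b) c (rootChoice c j₂)
  ... | c′ , c′≢c , c′≢c₂ =
    node zero lt c′ [] , refl , c′≢c ∘ cong (rootChoice c) , c′≢c₂ ∘ cong (rootChoice c)
  third-sibling 3≤b (node (suc k) lt c (a ∷ p)) j₂ _ with fresh₂ 3≤b a (lastChoice a j₂)
  ... | a′ , a′≢a , a′≢a₂ =
    node (suc k) lt c (a′ ∷ p) , refl , a′≢a ∘ cong (lastChoice a) , a′≢a₂ ∘ cong (lastChoice a)

module SiblingDifference {b h k : ℕ} {j₁ j₂ : Vtx (suc b) h} (k<h : k < h)
  (dj₁ : depth j₁ ≡ suc k) (dj₂ : depth j₂ ≡ suc k) (siblings : parent j₁ ≡ parent j₂) where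

  open Weight b h

  order : ℕ
  order = repunit b (suc (suc (h ∸ suc k)))

  order-annihilates : InRelations (suc b) h (+ order ·V (𝐱 j₁ -V 𝐱 j₂))
  order-annihilates =
    InRelations-resp-≗ pointwise
      (InRelations-+ (relator-at-level j₁ dj₁) (InRelations-· ℤ.-1ℤ (relator-at-level j₂ dj₂)))
    where
    N = h ∸ suc k
    relator-at-level : ∀ j → depth j ≡ suc k → InRelations (suc b) h (edge-relator (suc N) j)
    relator-at-level j dj = InRelations-edge-relator N j (subst (0 <_) (sym dj) (s≤s z≤n))
                                                         (trans (cong (ℕ._+ N) dj) (ℕₚ.m+[n∸m]≡n k<h))
    cancel : ∀ M α x y P → (M * x - α * P) + ℤ.-1ℤ * (M * y - α * P) ≡ M * (x - y)
    cancel = solve 5 (λ M α x y P → (M :* x :- α :* P) :+ con ℤ.-1ℤ :* (M :* y :- α :* P) := M :* (x :- y)) refl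
      where open +-*-Solver
    pointwise : ∀ u → (edge-relator (suc N) j₁ +V ℤ.-1ℤ ·V edge-relator (suc N) j₂) u
                      ≡ (+ order ·V (𝐱 j₁ -V 𝐱 j₂)) u
    pointwise u rewrite siblings =
      cancel (+ order) (+ repunit b (suc N)) (𝐱 j₁ u) (𝐱 j₂ u) (maybe′ 𝐱 0V (parent j₂) u)

  module _ (m : ℕ) (rel : InRelations (suc b) h (+ m ·V (𝐱 j₁ -V 𝐱 j₂))) where

    -- d = 3: the pair itself gives D j₁ − D j₂ = 2 = b; d ≥ 4: a third sibling gives 1.
    weight∣m·b·weight : 2 ≤ b → j₁ ≢ j₂ → weight k ∣ + m * (+ b * weight (suc k))
    weight∣m·b·weight 2≤b j₁≢j₂ with ℕₚ.m≤n⇒m<n∨m≡n 2≤b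
    ... | inj₂ 2≡b = subst (weight k ∣_) (cong (+ m *_) (trans (cong (weight (suc k) *_) difference)
                                                                (ℤₚ.*-comm (weight (suc k)) (+ b))))
                           (level-difference-∣ (siblings-balanced siblings) (s≤s z≤n) dj₁ dj₂ (+ m) rel)
      where
      open Potential (suc k) (𝐱 j₁ -V 𝐱 j₂)
      difference : (𝐱 j₁ -V 𝐱 j₂) j₁ - (𝐱 j₁ -V 𝐱 j₂) j₂ ≡ + b
      difference = trans (cong₂ _-_ (cong₂ _-_ (𝐱-≡ {q = j₁} refl) (𝐱-≢ {q = j₂} (j₁≢j₂ ∘ sym)))
                                    (cong₂ _-_ (𝐱-≢ {q = j₁} j₁≢j₂) (𝐱-≡ {q = j₂} refl)))
                         (cong +_ 2≡b)
    ... | inj₁ 3≤b with third-sibling 3≤b j₁ j₂ (subst (0 <_) (sym dj₁) (s≤s z≤n))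
    ...   | s , ps≡pj₁ , s≢j₁ , s≢j₂ =
      subst (weight k ∣_) (rearrange (weight (suc k)))
            (∣n⇒∣m*n (+ b) (level-difference-∣ (siblings-balanced (sym ps≡pj₁)) (s≤s z≤n) dj₁ dj₂ (+ m) rel))
      where
      open Potential (suc k) (𝐱 j₁ -V 𝐱 s)
      difference : (𝐱 j₁ -V 𝐱 s) j₁ - (𝐱 j₁ -V 𝐱 s) j₂ ≡ + 1
      difference = cong₂ _-_ (cong₂ _-_ (𝐱-≡ {q = j₁} refl) (𝐱-≢ {q = s} s≢j₁))
                             (cong₂ _-_ (𝐱-≢ {q = j₁} j₁≢j₂) (𝐱-≢ {q = s} s≢j₂))
      rearrange : ∀ α → + b * (+ m * (α * ((𝐱 j₁ -V 𝐱 s) j₁ - (𝐱 j₁ -V 𝐱 s) j₂))) ≡ + m * (+ b * α)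
      rearrange α rewrite difference =
        solve 3 (λ b m α → b :* (m :* (α :* con (+ 1))) := m :* (b :* α)) refl (+ b) (+ m) α
        where open +-*-Solver

    order-minimal : 2 ≤ b → j₁ ≢ j₂ → 0 < m → order ≤ m
    order-minimal 2≤b j₁≢j₂ 0<m = ℕ-∣⇒≤ {{ℕ.>-nonZero 0<m}} (∣⇒∣ᵤ (subst (_∣ + m) weight≡order weight∣m))
      where
      weight∣m : weight k ∣ + m
      weight∣m = ∣-1+ (+ m) (weight-pred k (ℕₚ.<⇒≤ k<h)) (weight∣m·b·weight 2≤b j₁≢j₂)
      weight≡order : weight k ≡ + order
      weight≡order = trans (weight-pred k (ℕₚ.<⇒≤ k<h))
                           (trans (cong (λ w → + 1 + + b * w) (weight-≤h (suc k) k<h))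
                                  (sym (repunit-sucℤ b (suc (h ∸ suc k)))))

proposition7p6 : (d h n : ℕ) (3≤d : 3 ≤ d) → 1 ≤ h → 1 ≤ n → n ≤ h →
    (j₁ j₂ : Vtx d h) → depth j₁ ≡ n → depth j₂ ≡ n →
    parent j₁ ≡ parent j₂ → j₁ ≢ j₂ →
    IsOrderIn d h (𝐱 j₁ -V 𝐱 j₂) (θ d (h ℕ.+ 2 ∸ n) 3≤d)
-- The hypothesis 1 ≤ h is implied by 1 ≤ n ≤ h.
proposition7p6 (suc b) h (suc k) (s≤s 2≤b) _ _ k<h j₁ j₂ dj₁ dj₂ siblings j₁≢j₂ =
  subst (IsOrderIn (suc b) h (𝐱 j₁ -V 𝐱 j₂)) (sym θ≡order)
        (s≤s z≤n , order-annihilates , λ m 0<m rel → order-minimal m rel 2≤b j₁≢j₂ 0<m)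
  where
  open SiblingDifference k<h dj₁ dj₂ siblings
  θ≡order : θ (suc b) (h ℕ.+ 2 ∸ suc k) (s≤s 2≤b) ≡ order
  θ≡order = trans (θ≡repunit b (h ℕ.+ 2 ∸ suc k) (s≤s 2≤b))
                  (cong (repunit b) (trans (ℕₚ.+-∸-comm 2 k<h) (ℕₚ.+-comm (h ∸ suc k) 2)))
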